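{- For every integer $k\ge 1$ and every integer $\ell\ge 0$, there are only finitely many (up to isomorphism) $k$-vertex-critical $(P_3+\ell P_1)$-free graphs.
   Context: All graphs are finite and simple. $\chi(G)$ is the chromatic number of $G$. A graph $G$ is $k$-vertex-critical if $\chi(G)=k$ and $\chi(G-v)<k$ for every vertex $v\in V(G)$. $P_n$ denotes the induced path on $n$ vertices, $P_1$ is a single vertex, $G+H$ denotes the disjoint union of $G$ and $H$, and $\ell P_1$ is the disjoint union of $\ell$ isolated vertices (so $P_3+0P_1=P_3$). A graph is $H$-free if it has no induced subgraph isomorphic to $H$. -}

module Defs where

open import Data.Nat using (ℕ; zero; suc; _<_)
open import Data.Fin using (Fin; toℕ; punchIn)
open import Data.Bool using (Bool; true; false; _∨_)
open import Data.Product using (Σ; _×_; ∃; ∃-syntax)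
open import Relation.Nullary using (¬_)
open import Relation.Binary.PropositionalEquality using (_≡_; _≢_)
open import Function.Bundles using (_↔_; Inverse)
open import Function.Definitions using (Injective)

record Graph (n : ℕ) : Set where
  field
    adj   : Fin n → Fin n → Bool
    sym   : ∀ i j → adj i j ≡ adj j i
    irrefl : ∀ i → adj i i ≡ false
open Graph public

Colourable : ∀ {n} → Graph n → ℕ → Set
Colourable {n} G k = Σ (Fin n → Fin k) λ c → ∀ i j → adj G i j ≡ true → c i ≢ c j

HasChromaticNumber : ∀ {n} → Graph n → ℕ → Set
HasChromaticNumber G k = Colourable G k × (∀ m → Colourable G m → ¬ (m < k))

deleteVertex : ∀ {m} → Graph (suc m) → Fin (suc m) → Graph m
deleteVertex G v = record
  { adj = λ i j → adj G (punchIn v i) (punchIn v j)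
  ; sym = λ i j → sym G (punchIn v i) (punchIn v j)
  ; irrefl = λ i → irrefl G (punchIn v i) }

VertexCritical : ℕ → ∀ {n} → Graph n → Set
VertexCritical k {zero} G = HasChromaticNumber G k
VertexCritical k {suc m} G =
  HasChromaticNumber G k × (∀ v → ∃[ j ] (j < k × HasChromaticNumber (deleteVertex G v) j))

InducedSub : ∀ {m n} → Graph m → Graph n → Set
InducedSub {m} {n} H G =
  Σ (Fin m → Fin n) λ f → Injective _≡_ _≡_ f × (∀ i j → adj H i j ≡ adj G (f i) (f j))

Free : ∀ {m n} → Graph m → Graph n → Set
Free H G = ¬ InducedSub H G

Iso : ∀ {m n} → Graph m → Graph n → Set
Iso {m} {n} G H =
  Σ (Fin m ↔ Fin n) λ φ → ∀ i j → adj G i j ≡ adj H (Inverse.to φ i) (Inverse.to φ j)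

p3edge : ℕ → ℕ → Bool
p3edge 0 1 = true
p3edge 1 0 = true
p3edge 1 2 = true
p3edge 2 1 = true
p3edge _ _ = false

private
  p3edge-sym : ∀ a b → p3edge a b ≡ p3edge b a
  p3edge-sym 0 0 = _≡_.refl
  p3edge-sym 0 1 = _≡_.refl
  p3edge-sym 0 2 = _≡_.refl
  p3edge-sym 0 (suc (suc (suc b))) = _≡_.refl
  p3edge-sym 1 0 = _≡_.refl
  p3edge-sym 1 1 = _≡_.refl
  p3edge-sym 1 2 = _≡_.refl
  p3edge-sym 1 (suc (suc (suc b))) = _≡_.refl
  p3edge-sym 2 0 = _≡_.refl
  p3edge-sym 2 1 = _≡_.refl
  p3edge-sym 2 2 = _≡_.refl
  p3edge-sym 2 (suc (suc (suc b))) = _≡_.refl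
  p3edge-sym (suc (suc (suc a))) 0 = _≡_.refl
  p3edge-sym (suc (suc (suc a))) 1 = _≡_.refl
  p3edge-sym (suc (suc (suc a))) 2 = _≡_.refl
  p3edge-sym (suc (suc (suc a))) (suc (suc (suc b))) = _≡_.refl

  p3edge-irr : ∀ a → p3edge a a ≡ false
  p3edge-irr 0 = _≡_.refl
  p3edge-irr 1 = _≡_.refl
  p3edge-irr 2 = _≡_.refl
  p3edge-irr (suc (suc (suc a))) = _≡_.refl

P3+ℓP1 : (ℓ : ℕ) → Graph (3 Data.Nat.+ ℓ)
P3+ℓP1 ℓ = record
  { adj = λ i j → p3edge (toℕ i) (toℕ j)
  ; sym = λ i j → p3edge-sym (toℕ i) (toℕ j)
  ; irrefl = λ i → p3edge-irr (toℕ i) }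

-- Let k + 1 be the chromatic number. A proper (k+1)-colouring splits the vertices into k + 1
-- independent sets, and the graphs of bounded order can be listed, so it suffices to show that a
-- (k+1)-vertex-critical (P₃ + ℓP₁)-free graph has no independent set I of size 2 + ℓ + 2kℓ.
-- Call a vertex outside I light if it has at most one neighbour in I, heavy otherwise. Freeness
-- forces a heavy vertex to miss fewer than ℓ vertices of I, and makes each set K m, made of the
-- m-th vertex of I and its light neighbours, a clique all of whose outside neighbours are heavy;
-- moreover a heavy vertex is non-adjacent to some vertex of at most 2ℓ of the sets K m. Pick K i of
-- least size and a k-colouring of G minus the i-th vertex of I. Fixing one heavy vertex of each
-- colour, some K m with m ≠ i is fully joined to all of them, so its (distinct) colours are unused
-- on heavy vertices. There are thus at least |K m| ≥ |K i| such colours, and recolouring K i with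
-- them yields a k-colouring of G.

module Submission where

open import Defs hiding (sym)
open import Level using (0ℓ)
open import Data.Nat using (ℕ; zero; suc; _+_; _*_; _≤_; _<_; z≤n; s≤s; _≤?_)
open import Data.Nat.Properties
  using ( ≤-refl; ≤-trans; ≤-reflexive; ≤-pred; <⇒≤; ≰⇒>; <⇒≱; ≤-<-trans; m≤n⇒m≤1+n; n≤1+n
        ; m≤n⇒m<n∨m≡n; m≤m+n; m≤n+m; +-suc; +-monoˡ-≤; +-monoʳ-≤; +-mono-≤; +-cancelˡ-≤
        ; module ≤-Reasoning )
open import Data.Fin using (Fin; zero; suc; inject≤; punchOut)
open import Data.Fin.Properties
  using (_≟_; any?; pigeonhole; suc-injective; <⇒≢; <-cmp; inject≤-injective; punchIn-punchOut; punchInᵢ≢i)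
open import Data.Bool using (Bool; true; false)
import Data.Bool.Properties as Bool
open import Data.Empty using (⊥; ⊥-elim)
open import Data.Unit using (tt)
open import Data.Product using (Σ; ∃; _×_; _,_; proj₁; proj₂)
open import Data.Sum using (_⊎_; inj₁; inj₂)
open import Data.List using (List; []; _∷_; [_]; _++_; map; cartesianProductWith)
open import Data.List.Relation.Unary.Any using (Any; here; there)
import Data.List.Relation.Unary.Any as Any
open import Data.List.Relation.Unary.Any.Properties using (++⁺ˡ; ++⁺ʳ; map⁺; cartesianProductWith⁺)
open import Data.Vec.Functional using (Vector; tail)
import Data.Vec.Functional as Vector
open import Function using (_∘_; id)
open import Function.Definitions using (Injective)
open import Function.Construct.Identity using (↔-id)
open import Relation.Nullary using (¬_; Dec; yes; no; ¬?; _×-dec_; _⊎-dec_; contradiction)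
open import Relation.Unary using (Pred; Decidable; _⊆_; _∪_; ∁)
open import Relation.Unary.Properties using (U?)
open import Relation.Binary using (Rel; tri<; tri≈; tri>)
open import Relation.Binary.PropositionalEquality using (_≡_; _≢_; refl; sym; trans; cong; subst; subst₂)

-- Counting the elements of decidable subsets of Fin n

count : ∀ {n} {P : Pred (Fin n) 0ℓ} → Decidable P → ℕ
count {zero}  P? = 0
count {suc n} P? with P? zero
... | yes _ = suc (count (P? ∘ suc))
... | no  _ = count (P? ∘ suc)

count-∪ : ∀ {n} {P Q R : Pred (Fin n) 0ℓ} (P? : Decidable P) (Q? : Decidable Q) (R? : Decidable R) →
          P ⊆ Q ∪ R → count P? ≤ count Q? + count R?
count-∪ {zero} P? Q? R? P⊆Q∪R = z≤n
count-∪ {suc n} P? Q? R? P⊆Q∪R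
  with IH ← count-∪ (P? ∘ suc) (Q? ∘ suc) (R? ∘ suc) P⊆Q∪R
  with P? zero | Q? zero | R? zero
... | no _  | no _  | no _  = IH
... | no _  | no _  | yes _ = ≤-trans IH (+-monoʳ-≤ _ (n≤1+n _))
... | no _  | yes _ | no _  = m≤n⇒m≤1+n IH
... | no _  | yes _ | yes _ = m≤n⇒m≤1+n (≤-trans IH (+-monoʳ-≤ _ (n≤1+n _)))
... | yes _ | yes _ | no _  = s≤s IH
... | yes _ | no _  | yes _ = ≤-trans (s≤s IH) (≤-reflexive (sym (+-suc _ _)))
... | yes _ | yes _ | yes _ = s≤s (≤-trans IH (+-monoʳ-≤ _ (n≤1+n _)))
... | yes p | no ¬q | no ¬r with P⊆Q∪R p
...   | inj₁ q = contradiction q ¬q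
...   | inj₂ r = contradiction r ¬r

count-⊆ : ∀ {n} {P Q : Pred (Fin n) 0ℓ} (P? : Decidable P) (Q? : Decidable Q) → P ⊆ Q → count P? ≤ count Q?
count-⊆ {zero}  P? Q? P⊆Q = z≤n
count-⊆ {suc n} P? Q? P⊆Q with IH ← count-⊆ (P? ∘ suc) (Q? ∘ suc) P⊆Q with P? zero | Q? zero
... | yes _ | yes _ = s≤s IH
... | no _  | yes _ = m≤n⇒m≤1+n IH
... | no _  | no _  = IH
... | yes p | no ¬q = contradiction (P⊆Q p) ¬q

count+count-∁ : ∀ {n} {P : Pred (Fin n) 0ℓ} (P? : Decidable P) → count P? + count (¬? ∘ P?) ≡ n
count+count-∁ {zero}  P? = refl
count+count-∁ {suc n} P? with P? zero
... | yes _ = cong suc (count+count-∁ (P? ∘ suc))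
... | no  _ = trans (+-suc _ _) (cong suc (count+count-∁ (P? ∘ suc)))

count<n⇒∃∁ : ∀ {n} {P : Pred (Fin n) 0ℓ} (P? : Decidable P) → count P? < n → ∃ (∁ P)
count<n⇒∃∁ {zero}  P? ()
count<n⇒∃∁ {suc n} P? c<n with P? zero
... | no ¬p = zero , ¬p
... | yes _ with x , ¬px ← count<n⇒∃∁ (P? ∘ suc) (≤-pred c<n) = suc x , ¬px

rank : ∀ {n} {P : Pred (Fin n) 0ℓ} (P? : Decidable P) (x : Fin n) → P x → Fin (count P?)
rank {suc n} P? x px with P? zero
rank {suc n} P? zero    px | yes _  = zero
rank {suc n} P? (suc x) px | yes _  = suc (rank (P? ∘ suc) x px)
rank {suc n} P? zero    px | no ¬p0 = contradiction px ¬p0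
rank {suc n} P? (suc x) px | no _   = rank (P? ∘ suc) x px

rank-injective : ∀ {n} {P : Pred (Fin n) 0ℓ} (P? : Decidable P) {x y} (px : P x) (py : P y) →
                 rank P? x px ≡ rank P? y py → x ≡ y
rank-injective {suc n} P? {x} {y} px py eq with P? zero
rank-injective {suc n} P? {zero}  {zero}  px py eq | yes _ = refl
rank-injective {suc n} P? {suc x} {suc y} px py eq | yes _ =
  cong suc (rank-injective (P? ∘ suc) px py (suc-injective eq))
rank-injective {suc n} P? {zero}  {_}     px py eq | no ¬p0 = contradiction px ¬p0
rank-injective {suc n} P? {suc x} {zero}  px py eq | no ¬p0 = contradiction py ¬p0
rank-injective {suc n} P? {suc x} {suc y} px py eq | no _ =
  cong suc (rank-injective (P? ∘ suc) px py eq)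

enum : ∀ {n} {P : Pred (Fin n) 0ℓ} (P? : Decidable P) → Fin (count P?) → Fin n
enum {suc n} P? i with P? zero
enum {suc n} P? zero    | yes _ = zero
enum {suc n} P? (suc i) | yes _ = suc (enum (P? ∘ suc) i)
enum {suc n} P? i       | no _  = suc (enum (P? ∘ suc) i)

enum-∈ : ∀ {n} {P : Pred (Fin n) 0ℓ} (P? : Decidable P) i → P (enum P? i)
enum-∈ {suc n} P? i with P? zero
enum-∈ {suc n} P? zero    | yes p0 = p0
enum-∈ {suc n} P? (suc i) | yes _  = enum-∈ (P? ∘ suc) i
enum-∈ {suc n} P? i       | no _   = enum-∈ (P? ∘ suc) i

enum-injective : ∀ {n} {P : Pred (Fin n) 0ℓ} (P? : Decidable P) {i j} → enum P? i ≡ enum P? j → i ≡ j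
enum-injective {suc n} P? {i} {j} eq with P? zero
enum-injective {suc n} P? {zero}  {zero}  eq | yes _ = refl
enum-injective {suc n} P? {suc i} {suc j} eq | yes _ =
  cong suc (enum-injective (P? ∘ suc) (suc-injective eq))
enum-injective {suc n} P? {i}     {j}     eq | no _ = enum-injective (P? ∘ suc) (suc-injective eq)

≤count⇒embedding : ∀ {m n} {P : Pred (Fin n) 0ℓ} (P? : Decidable P) → m ≤ count P? →
                   Σ (Fin m → Fin n) λ f → Injective _≡_ _≡_ f × (∀ i → P (f i))
≤count⇒embedding P? m≤c =
  (λ i → enum P? (inject≤ i m≤c)) ,
  (λ eq → inject≤-injective m≤c m≤c _ _ (enum-injective P? eq)) ,
  (λ i → enum-∈ P? (inject≤ i m≤c))

embedding⇒≤count : ∀ {m n} {P : Pred (Fin n) 0ℓ} (P? : Decidable P) (f : Fin m → Fin n) →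
                   Injective _≡_ _≡_ f → (∀ i → P (f i)) → m ≤ count P?
embedding⇒≤count {m} P? f f-inj f∈P with m ≤? count P?
... | yes m≤c = m≤c
... | no m≰c with i , j , i<j , eq ← pigeonhole (≰⇒> m≰c) (λ i → rank P? (f i) (f∈P i)) =
  contradiction (f-inj (rank-injective P? (f∈P i) (f∈P j) eq)) (<⇒≢ i<j)

count≤1⇒unique : ∀ {n} {P : Pred (Fin n) 0ℓ} (P? : Decidable P) → count P? ≤ 1 →
                 ∀ {x y} → P x → P y → x ≡ y
count≤1⇒unique {P = P} P? c≤1 {x} {y} px py with x ≟ y
... | yes x≡y = x≡y
... | no x≢y = contradiction (embedding⇒≤count P? pair pair-injective pair∈P) (<⇒≱ (s≤s c≤1))
  where
  pair : Fin 2 → Fin _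
  pair zero = x
  pair (suc zero) = y
  pair-injective : Injective _≡_ _≡_ pair
  pair-injective {zero}     {zero}     _  = refl
  pair-injective {zero}     {suc zero} eq = contradiction eq x≢y
  pair-injective {suc zero} {zero}     eq = contradiction (sym eq) x≢y
  pair-injective {suc zero} {suc zero} _  = refl
  pair∈P : ∀ i → P (pair i)
  pair∈P zero = px
  pair∈P (suc zero) = py

unique⇒count≤1 : ∀ {n} {P : Pred (Fin n) 0ℓ} (P? : Decidable P) →
                 (∀ {x y} → P x → P y → x ≡ y) → count P? ≤ 1
unique⇒count≤1 P? unique with 2 ≤? count P?
... | no 2≰c = ≤-pred (≰⇒> 2≰c)
... | yes 2≤c with f , f-inj , f∈P ← ≤count⇒embedding P? 2≤c
  with () ← f-inj {zero} {suc zero} (unique (f∈P zero) (f∈P (suc zero)))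

count-≟ : ∀ {n} (m : Fin n) → count (_≟ m) ≤ 1
count-≟ m = unique⇒count≤1 (_≟ m) λ x≡m y≡m → trans x≡m (sym y≡m)

count-∅ : ∀ {n} {P : Pred (Fin n) 0ℓ} (P? : Decidable P) → (∀ x → ¬ P x) → count P? ≡ 0
count-∅ {zero}  P? empty = refl
count-∅ {suc n} P? empty with P? zero
... | yes p0 = contradiction p0 (empty zero)
... | no  _  = count-∅ (P? ∘ suc) (empty ∘ suc)

count-⋃ : ∀ {k n c} {P : Pred (Fin n) 0ℓ} {Q : Fin k → Pred (Fin n) 0ℓ}
          (P? : Decidable P) (Q? : ∀ γ → Decidable (Q γ)) →
          (∀ {x} → P x → ∃ λ γ → Q γ x) → (∀ γ → count (Q? γ) ≤ c) → count P? ≤ k * c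
count-⋃ {zero} {P = P} P? Q? cover bound = ≤-reflexive (count-∅ P? empty)
  where
  empty : ∀ x → ¬ P x
  empty x px with () ← proj₁ (cover px)
count-⋃ {suc k} {P = P} {Q = Q} P? Q? cover bound =
  ≤-trans (count-∪ P? (Q? zero) Q⁺? split)
          (+-mono-≤ (bound zero) (count-⋃ Q⁺? (Q? ∘ suc) (λ q⁺ → q⁺) (bound ∘ suc)))
  where
  Q⁺? : Decidable (λ x → ∃ λ γ → Q (suc γ) x)
  Q⁺? x = any? (λ γ → Q? (suc γ) x)
  split : ∀ {x} → P x → Q zero x ⊎ ∃ λ γ → Q (suc γ) x
  split px with cover px
  ... | zero  , q = inj₁ q
  ... | suc γ , q = inj₂ (γ , q)

argmin : ∀ {t} (f : Fin (suc t) → ℕ) → ∃ λ i → ∀ j → f i ≤ f j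
argmin {zero}  f = zero , λ { zero → ≤-refl }
argmin {suc t} f with i , fi≤ ← argmin (f ∘ suc) with f zero ≤? f (suc i)
... | yes f0≤fi = zero , λ { zero → ≤-refl ; (suc j) → ≤-trans f0≤fi (fi≤ j) }
... | no  f0≰fi = suc i , λ { zero → <⇒≤ (≰⇒> f0≰fi) ; (suc j) → fi≤ j }

-- Adjacency and induced copies of P₃ + ℓP₁

module Adjacency {n : ℕ} (G : Graph n) where

  infix 4 _~_ _≁_ _~?_ _≁?_

  _~_ _≁_ : Fin n → Fin n → Set
  x ~ y = adj G x y ≡ true
  x ≁ y = adj G x y ≡ false

  _~?_ : ∀ x y → Dec (x ~ y)
  x ~? y = adj G x y Bool.≟ true

  _≁?_ : ∀ x y → Dec (x ≁ y)
  x ≁? y = adj G x y Bool.≟ false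

  adj-sym : ∀ {x y b} → adj G x y ≡ b → adj G y x ≡ b
  adj-sym {x} {y} eq = trans (Graph.sym G y x) eq

  ¬~⇒≁ : ∀ {x y} → ¬ x ~ y → x ≁ y
  ¬~⇒≁ = Bool.¬-not

  ~⇒≢ : ∀ {x y} → x ~ y → x ≢ y
  ~⇒≢ {x} x~y refl with () ← trans (sym x~y) (irrefl G x)

  ~-≁-distinguish : ∀ {x y z} → x ~ z → y ≁ z → x ≢ y
  ~-≁-distinguish x~z y≁z refl with () ← trans (sym x~z) y≁z

  P3+ℓP1-induced : ∀ {ℓ} {x y z} (w : Fin ℓ → Fin n) →
                   x ~ y → y ~ z → x ≁ z → x ≢ z →
                   (∀ j → x ≁ w j) → (∀ j → y ≁ w j) → (∀ j → z ≁ w j) →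
                   (∀ j j′ → w j ≁ w j′) → Injective _≡_ _≡_ w →
                   InducedSub (P3+ℓP1 ℓ) G
  P3+ℓP1-induced {ℓ} {x} {y} {z} w x~y y~z x≁z x≢z x≁w y≁w z≁w w≁w w-inj = f , f-inj , f-adj
    where
    f : Fin (3 + ℓ) → Fin n
    f zero                = x
    f (suc zero)          = y
    f (suc (suc zero))    = z
    f (suc (suc (suc j))) = w j
    x≢w : ∀ j → x ≢ w j
    x≢w j = ~-≁-distinguish x~y (adj-sym (y≁w j))
    y≢w : ∀ j → y ≢ w j
    y≢w j = ~-≁-distinguish (adj-sym x~y) (adj-sym (x≁w j))
    z≢w : ∀ j → z ≢ w j
    z≢w j = ~-≁-distinguish (adj-sym y~z) (adj-sym (y≁w j))
    x≢y : x ≢ y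
    x≢y = ~⇒≢ x~y
    y≢z : y ≢ z
    y≢z = ~⇒≢ y~z
    f-inj : Injective _≡_ _≡_ f
    f-inj {zero}                {zero}                 _  = refl
    f-inj {zero}                {suc zero}             eq = contradiction eq x≢y
    f-inj {zero}                {suc (suc zero)}       eq = contradiction eq x≢z
    f-inj {zero}                {suc (suc (suc j))}    eq = contradiction eq (x≢w j)
    f-inj {suc zero}            {zero}                 eq = contradiction (sym eq) x≢y
    f-inj {suc zero}            {suc zero}             _  = refl
    f-inj {suc zero}            {suc (suc zero)}       eq = contradiction eq y≢z
    f-inj {suc zero}            {suc (suc (suc j))}    eq = contradiction eq (y≢w j)
    f-inj {suc (suc zero)}      {zero}                 eq = contradiction (sym eq) x≢z
    f-inj {suc (suc zero)}      {suc zero}             eq = contradiction (sym eq) y≢z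
    f-inj {suc (suc zero)}      {suc (suc zero)}       _  = refl
    f-inj {suc (suc zero)}      {suc (suc (suc j))}    eq = contradiction eq (z≢w j)
    f-inj {suc (suc (suc i))}   {zero}                 eq = contradiction (sym eq) (x≢w i)
    f-inj {suc (suc (suc i))}   {suc zero}             eq = contradiction (sym eq) (y≢w i)
    f-inj {suc (suc (suc i))}   {suc (suc zero)}       eq = contradiction (sym eq) (z≢w i)
    f-inj {suc (suc (suc i))}   {suc (suc (suc j))}    eq = cong (λ j → suc (suc (suc j))) (w-inj eq)
    f-adj : ∀ i j → adj (P3+ℓP1 ℓ) i j ≡ adj G (f i) (f j)
    f-adj zero                zero                = sym (irrefl G x)
    f-adj zero                (suc zero)          = sym x~y
    f-adj zero                (suc (suc zero))    = sym x≁z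
    f-adj zero                (suc (suc (suc j))) = sym (x≁w j)
    f-adj (suc zero)          zero                = sym (adj-sym x~y)
    f-adj (suc zero)          (suc zero)          = sym (irrefl G y)
    f-adj (suc zero)          (suc (suc zero))    = sym y~z
    f-adj (suc zero)          (suc (suc (suc j))) = sym (y≁w j)
    f-adj (suc (suc zero))    zero                = sym (adj-sym x≁z)
    f-adj (suc (suc zero))    (suc zero)          = sym (adj-sym y~z)
    f-adj (suc (suc zero))    (suc (suc zero))    = sym (irrefl G z)
    f-adj (suc (suc zero))    (suc (suc (suc j))) = sym (z≁w j)
    f-adj (suc (suc (suc i))) zero                = sym (adj-sym (x≁w i))
    f-adj (suc (suc (suc i))) (suc zero)          = sym (adj-sym (y≁w i))
    f-adj (suc (suc (suc i))) (suc (suc zero))    = sym (adj-sym (z≁w i))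
    f-adj (suc (suc (suc i))) (suc (suc (suc j))) = sym (w≁w i j)

-- Critical graphs have no large independent set

ColourableExcept : ∀ {n} → Graph n → ℕ → Fin n → Set
ColourableExcept {n} G k v =
  Σ (Fin n → Fin k) λ col → ∀ {x y} → x ≢ v → y ≢ v → adj G x y ≡ true → col x ≢ col y

-- The vertex w only supplies some colour for v.
critical⇒colourableExcept : ∀ {k n} {G : Graph (suc n)} → VertexCritical (suc k) G →
                            ∀ {v w} → v ≢ w → ColourableExcept G k v
critical⇒colourableExcept {k} {G = G} (_ , critical) {v} v≢w
  with j , j<1+k , (c , c-proper) , _ ← critical v = col , col-proper
  where
  j≤k : j ≤ k
  j≤k = ≤-pred j<1+k
  col : Fin _ → Fin k
  col x with v ≟ x
  ... | yes _   = inject≤ (c (punchOut v≢w)) j≤k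
  ... | no  v≢x = inject≤ (c (punchOut v≢x)) j≤k
  col-proper : ∀ {x y} → x ≢ v → y ≢ v → adj G x y ≡ true → col x ≢ col y
  col-proper {x} {y} x≢v y≢v x~y with v ≟ x | v ≟ y
  ... | yes v≡x | _       = contradiction (sym v≡x) x≢v
  ... | no  _   | yes v≡y = contradiction (sym v≡y) y≢v
  ... | no  v≢x | no  v≢y = c-proper (punchOut v≢x) (punchOut v≢y)
    (subst₂ (λ a b → adj G a b ≡ true) (sym (punchIn-punchOut v≢x)) (sym (punchIn-punchOut v≢y)) x~y)
    ∘ inject≤-injective j≤k j≤k _ _

module LargeIndependentSet
  {N : ℕ} (G : Graph N) (ℓ : ℕ) (free : Free (P3+ℓP1 ℓ) G)
  {t : ℕ} (ι : Fin t → Fin N) (ι-injective : Injective _≡_ _≡_ ι)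
  (ι-independent : ∀ r s → adj G (ι r) (ι s) ≡ false) (2+ℓ≤t : 2 + ℓ ≤ t) where

  open Adjacency G

  InI : Pred (Fin N) 0ℓ
  InI x = ∃ λ r → ι r ≡ x

  InI? : Decidable InI
  InI? x = any? λ r → ι r ≟ x

  deg : Fin N → ℕ
  deg x = count λ r → x ~? ι r

  Light Heavy : Pred (Fin N) 0ℓ
  Light x = ¬ InI x × deg x ≤ 1
  Heavy x = ¬ InI x × 2 ≤ deg x

  Light? : Decidable Light
  Light? x = ¬? (InI? x) ×-dec (deg x ≤? 1)

  Heavy? : Decidable Heavy
  Heavy? x = ¬? (InI? x) ×-dec (2 ≤? deg x)

  K : Fin t → Pred (Fin N) 0ℓ
  K m v = ι m ≡ v ⊎ (Light v × v ~ ι m)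

  K? : ∀ m → Decidable (K m)
  K? m v = (ι m ≟ v) ⊎-dec (Light? v ×-dec (v ~? ι m))

  no-P3-anticomplete : ∀ {x y z} → x ~ y → y ~ z → x ≁ z → x ≢ z →
                       ∀ {S : Pred (Fin t) 0ℓ} (S? : Decidable S) → ℓ ≤ count S? →
                       (∀ {r} → S r → x ≁ ι r × y ≁ ι r × z ≁ ι r) → ⊥
  no-P3-anticomplete x~y y~z x≁z x≢z S? ℓ≤S avoid
    with w , w-inj , w∈S ← ≤count⇒embedding S? ℓ≤S =
    free (P3+ℓP1-induced (ι ∘ w) x~y y~z x≁z x≢z
           (proj₁ ∘ avoid ∘ w∈S) (proj₁ ∘ proj₂ ∘ avoid ∘ w∈S) (proj₂ ∘ proj₂ ∘ avoid ∘ w∈S)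
           (λ _ _ → ι-independent _ _) (w-inj ∘ ι-injective))

  ℓ≤count-outside : ∀ {S : Pred (Fin t) 0ℓ} (S? : Decidable S) → count S? ≤ 2 → ℓ ≤ count (¬? ∘ S?)
  ℓ≤count-outside S? S≤2 = +-cancelˡ-≤ 2 ℓ (count (¬? ∘ S?)) (begin
    2 + ℓ                        ≤⟨ 2+ℓ≤t ⟩
    t                            ≡⟨ sym (count+count-∁ S?) ⟩
    count S? + count (¬? ∘ S?)   ≤⟨ +-monoˡ-≤ _ S≤2 ⟩
    2 + count (¬? ∘ S?)          ∎)
    where open ≤-Reasoning

  ℓ≤count-≢ : ∀ m → ℓ ≤ count (λ r → ¬? (r ≟ m))
  ℓ≤count-≢ m = ℓ≤count-outside (_≟ m) (≤-trans (count-≟ m) (s≤s z≤n))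

  light-neighbour-unique : ∀ {b m m′} → Light b → b ~ ι m → b ~ ι m′ → m ≡ m′
  light-neighbour-unique (_ , deg≤1) = count≤1⇒unique _ deg≤1

  light-misses-others : ∀ {b m r} → Light b → b ~ ι m → r ≢ m → b ≁ ι r
  light-misses-others light b~m r≢m = ¬~⇒≁ λ b~r → r≢m (light-neighbour-unique light b~r b~m)

  heavy≢light : ∀ {a b} → Heavy a → Light b → a ≢ b
  heavy≢light (_ , 2≤deg) (_ , deg≤1) refl = <⇒≱ (s≤s deg≤1) 2≤deg

  heavy-misses<ℓ : ∀ {a} → Heavy a → count (λ r → a ≁? ι r) < ℓ
  heavy-misses<ℓ {a} (_ , 2≤deg) with ℓ ≤? count (λ r → a ≁? ι r)
  ... | no ℓ≰ = ≰⇒> ℓ≰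
  ... | yes ℓ≤ with f , f-inj , a~f ← ≤count⇒embedding (λ r → a ~? ι r) 2≤deg =
    ⊥-elim (no-P3-anticomplete (adj-sym (a~f zero)) (a~f (suc zero)) (ι-independent _ _)
             (λ eq → contradiction (f-inj (ι-injective eq)) λ ()) (λ r → a ≁? ι r) ℓ≤
             (λ a≁r → ι-independent _ _ , a≁r , ι-independent _ _))

  K-clique : ∀ {m u v} → K m u → K m v → u ≢ v → u ~ v
  K-clique (inj₁ refl) (inj₁ refl)            u≢v = contradiction refl u≢v
  K-clique (inj₁ refl) (inj₂ (_ , v~m))       _   = adj-sym v~m
  K-clique (inj₂ (_ , u~m)) (inj₁ refl)       _   = u~m
  K-clique {m} {u} {v} (inj₂ (lu , u~m)) (inj₂ (lv , v~m)) u≢v with u ~? v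
  ... | yes u~v = u~v
  ... | no u≁v = ⊥-elim (no-P3-anticomplete u~m (adj-sym v~m) (¬~⇒≁ u≁v) u≢v _ (ℓ≤count-≢ m)
                   λ r≢m → light-misses-others lu u~m r≢m , ι-independent _ _ , light-misses-others lv v~m r≢m)

  K-neighbour-outside-I : ∀ {m v w} → K m v → ¬ K m w → v ~ w → ¬ InI w
  K-neighbour-outside-I (inj₁ refl) _ m~w (s , refl) with () ← trans (sym m~w) (ι-independent _ s)
  K-neighbour-outside-I (inj₂ (lv , v~m)) w∉K v~w (s , refl) =
    w∉K (inj₁ (cong ι (light-neighbour-unique lv v~m v~w)))

  K-neighbour-heavy : ∀ {m v w} → K m v → ¬ K m w → v ~ w → Heavy w
  K-neighbour-heavy {m} {v} {w} v∈K w∉K v~w with w∉I ← K-neighbour-outside-I v∈K w∉K v~w with 2 ≤? deg w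
  ... | yes 2≤deg = w∉I , 2≤deg
  ... | no 2≰deg = ⊥-elim (light-outside v∈K)
    where
    lw : Light w
    lw = w∉I , ≤-pred (≰⇒> 2≰deg)
    w≁m : w ≁ ι m
    w≁m = ¬~⇒≁ λ w~m → w∉K (inj₂ (lw , w~m))
    Excluded? : Decidable λ r → r ≡ m ⊎ w ~ ι r
    Excluded? r = (r ≟ m) ⊎-dec (w ~? ι r)
    few-excluded : count Excluded? ≤ 2
    few-excluded = ≤-trans (count-∪ Excluded? (_≟ m) (λ r → w ~? ι r) λ e → e)
                           (+-mono-≤ (count-≟ m) (proj₂ lw))
    -- Otherwise ι m, v, w would be an induced P₃ beside ℓ further vertices of I.
    light-outside : K m v → ⊥
    light-outside (inj₁ refl) with () ← trans (sym v~w) (adj-sym w≁m)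
    light-outside (inj₂ (lv , v~m)) =
      no-P3-anticomplete (adj-sym v~m) v~w (adj-sym w≁m) (λ m≡w → w∉I (m , m≡w)) _
        (ℓ≤count-outside Excluded? few-excluded)
        λ r∉E → ι-independent _ _ , light-misses-others lv v~m (r∉E ∘ inj₁) , ¬~⇒≁ (r∉E ∘ inj₂)

  lights-nonadjacent : ∀ {b b′ m m′} → Light b → b ~ ι m → Light b′ → b′ ~ ι m′ → m ≢ m′ → b ≁ b′
  lights-nonadjacent lb b~m lb′ b′~m′ m≢m′ = ¬~⇒≁ λ b~b′ →
    heavy≢light (K-neighbour-heavy (inj₂ (lb , b~m)) b′∉K b~b′) lb′ refl
    where
    b′∉K : ¬ K _ _
    b′∉K (inj₁ refl)         = proj₁ lb′ (_ , refl)
    b′∉K (inj₂ (_ , b′~m))   = m≢m′ (light-neighbour-unique lb′ b′~m b′~m′)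

  attached-lights-independent : ∀ {q} {s : Fin q → Fin t} {b : Fin q → Fin N} → Injective _≡_ _≡_ s →
                                (∀ j → Light (b j)) → (∀ j → b j ~ ι (s j)) →
                                Injective _≡_ _≡_ b × (∀ j j′ → b j ≁ b j′)
  attached-lights-independent {b = b} s-inj light b~s =
    (λ {j} {j′} eq → s-inj (light-neighbour-unique (light j) (b~s j) (subst (_~ _) (sym eq) (b~s j′)))) ,
    nonadjacent
    where
    nonadjacent : ∀ j j′ → b j ≁ b j′
    nonadjacent j j′ with j ≟ j′
    ... | yes refl = irrefl G (b j)
    ... | no j≢j′ = lights-nonadjacent (light j) (b~s j) (light j′) (b~s j′) (j≢j′ ∘ s-inj)

  MissesLight : Fin N → Pred (Fin t) 0ℓ
  MissesLight a m = ∃ λ b → Light b × b ~ ι m × a ≁ b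

  MissesLight? : ∀ a → Decidable (MissesLight a)
  MissesLight? a m = any? λ b → Light? b ×-dec (b ~? ι m) ×-dec (a ≁? b)

  OtherMissed : Fin N → Fin t → Pred (Fin t) 0ℓ
  OtherMissed a m₀ m = m ≢ m₀ × MissesLight a m

  OtherMissed? : ∀ a m₀ → Decidable (OtherMissed a m₀)
  OtherMissed? a m₀ m = ¬? (m ≟ m₀) ×-dec MissesLight? a m

  -- b₀, ι m₀, a is an induced P₃, and the light vertices witnessing the other missed indices are
  -- ℓ independent vertices anticomplete to it.
  heavy-P3-through-lights : ∀ {a b₀ m₀} → Heavy a → Light b₀ → b₀ ~ ι m₀ → a ~ ι m₀ → a ≁ b₀ →
                            ℓ ≤ count (OtherMissed? a m₀) → ⊥
  heavy-P3-through-lights {a} {b₀} {m₀} ha lb₀ b₀~m₀ a~m₀ a≁b₀ ℓ≤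
    with s , s-inj , s∈ ← ≤count⇒embedding (OtherMissed? a m₀) ℓ≤ =
    free (P3+ℓP1-induced b b₀~m₀ (adj-sym a~m₀) (adj-sym a≁b₀) (λ b₀≡a → heavy≢light ha lb₀ (sym b₀≡a))
           (λ j → lights-nonadjacent lb₀ b₀~m₀ (lb j) (b~s j) (m₀≢s j))
           (λ j → adj-sym (light-misses-others (lb j) (b~s j) (m₀≢s j)))
           (λ j → proj₂ (proj₂ (proj₂ (missed j))))
           (proj₂ b-independent) (proj₁ b-independent))
    where
    missed : ∀ j → MissesLight a (s j)
    missed = proj₂ ∘ s∈
    b : Fin ℓ → Fin N
    b = proj₁ ∘ missed
    lb : ∀ j → Light (b j)
    lb = proj₁ ∘ proj₂ ∘ missed
    b~s : ∀ j → b j ~ ι (s j)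
    b~s = proj₁ ∘ proj₂ ∘ proj₂ ∘ missed
    m₀≢s : ∀ j → m₀ ≢ s j
    m₀≢s j = proj₁ (s∈ j) ∘ sym
    b-independent : Injective _≡_ _≡_ b × (∀ j j′ → b j ≁ b j′)
    b-independent = attached-lights-independent s-inj lb b~s

  heavy-misses-light≤ℓ : ∀ {a} → Heavy a → count (MissesLight? a) ≤ ℓ
  heavy-misses-light≤ℓ {a} ha with any? (λ m → MissesLight? a m ×-dec (a ~? ι m))
  ... | no none = ≤-trans (count-⊆ _ _ λ {m} missed → ¬~⇒≁ λ a~m → none (m , missed , a~m))
                          (<⇒≤ (heavy-misses<ℓ ha))
  ... | yes (m₀ , (b₀ , lb₀ , b₀~m₀ , a≁b₀) , a~m₀) with suc ℓ ≤? count (MissesLight? a)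
  ...   | no 1+ℓ≰ = ≤-pred (≰⇒> 1+ℓ≰)
  ...   | yes 1+ℓ≤ = ⊥-elim (heavy-P3-through-lights ha lb₀ b₀~m₀ a~m₀ a≁b₀ ℓ≤others)
    where
    split : ∀ {m} → MissesLight a m → m ≡ m₀ ⊎ OtherMissed a m₀ m
    split {m} missed with m ≟ m₀
    ... | yes m≡m₀ = inj₁ m≡m₀
    ... | no m≢m₀ = inj₂ (m≢m₀ , missed)
    ℓ≤others : ℓ ≤ count (OtherMissed? a m₀)
    ℓ≤others = +-cancelˡ-≤ 1 ℓ _ (≤-trans 1+ℓ≤
                 (≤-trans (count-∪ (MissesLight? a) (_≟ m₀) (OtherMissed? a m₀) split)
                          (+-monoˡ-≤ _ (count-≟ m₀))))

  Misses : Fin N → Pred (Fin t) 0ℓ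
  Misses a m = ∃ λ v → K m v × a ≁ v

  Misses? : ∀ a → Decidable (Misses a)
  Misses? a m = any? λ v → K? m v ×-dec (a ≁? v)

  heavy-misses≤2ℓ : ∀ {a} → Heavy a → count (Misses? a) ≤ ℓ + ℓ
  heavy-misses≤2ℓ {a} ha =
    ≤-trans (count-∪ (Misses? a) (λ m → a ≁? ι m) (MissesLight? a) split)
            (+-mono-≤ (<⇒≤ (heavy-misses<ℓ ha)) (heavy-misses-light≤ℓ ha))
    where
    split : ∀ {m} → Misses a m → a ≁ ι m ⊎ MissesLight a m
    split (_ , inj₁ refl       , a≁m) = inj₁ a≁m
    split (v , inj₂ (lv , v~m) , a≁v) = inj₂ (v , lv , v~m , a≁v)

  K-avoids-ι : ∀ {m i v} → m ≢ i → K m v → v ≢ ι i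
  K-avoids-ι m≢i (inj₁ refl)     = m≢i ∘ ι-injective
  K-avoids-ι m≢i (inj₂ (lv , _)) = λ v≡i → proj₁ lv (_ , sym v≡i)

  module Recolouring {k : ℕ} (i : Fin t) (i-minimal : ∀ m → count (K? i) ≤ count (K? m))
    (colouring : ColourableExcept G k (ι i)) (1+2ℓk<t : suc (k * (ℓ + ℓ)) < t) where

    open Σ colouring renaming (proj₁ to col; proj₂ to col-proper)

    HeavyOfColour : Fin k → Pred (Fin N) 0ℓ
    HeavyOfColour σ a = Heavy a × col a ≡ σ

    HeavyOfColour? : ∀ σ → Decidable (HeavyOfColour σ)
    HeavyOfColour? σ a = Heavy? a ×-dec (col a ≟ σ)

    -- ι i is only a default: it is not heavy.
    representative : Fin k → Fin N
    representative σ with any? (HeavyOfColour? σ)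
    ... | yes (a , _) = a
    ... | no  _       = ι i

    representative-spec : ∀ {σ a} → HeavyOfColour σ a → HeavyOfColour σ (representative σ)
    representative-spec {σ} {a} h with any? (HeavyOfColour? σ)
    ... | yes (_ , h′) = h′
    ... | no  none     = contradiction (a , h) none

    BadFor : Fin k → Pred (Fin t) 0ℓ
    BadFor σ m = Heavy (representative σ) × Misses (representative σ) m

    BadFor? : ∀ σ → Decidable (BadFor σ)
    BadFor? σ m = Heavy? (representative σ) ×-dec Misses? (representative σ) m

    BadFor≤2ℓ : ∀ σ → count (BadFor? σ) ≤ ℓ + ℓ
    BadFor≤2ℓ σ = bound (Heavy? (representative σ))
      where
      bound : Dec (Heavy (representative σ)) → count (BadFor? σ) ≤ ℓ + ℓ
      bound (yes h)  = ≤-trans (count-⊆ (BadFor? σ) (Misses? _) proj₂) (heavy-misses≤2ℓ h)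
      bound (no  ¬h) = ≤-trans (≤-reflexive (count-∅ (BadFor? σ) λ _ → ¬h ∘ proj₁)) z≤n

    Bad : Pred (Fin t) 0ℓ
    Bad m = m ≡ i ⊎ ∃ λ σ → BadFor σ m

    Bad? : Decidable Bad
    Bad? m = (m ≟ i) ⊎-dec any? λ σ → BadFor? σ m

    good : ∃ λ m → ¬ Bad m
    good = count<n⇒∃∁ Bad? (≤-<-trans count-Bad 1+2ℓk<t)
      where
      count-Bad : count Bad? ≤ suc (k * (ℓ + ℓ))
      count-Bad = ≤-trans (count-∪ Bad? (_≟ i) BadForSome? λ b → b)
                          (+-mono-≤ (count-≟ i) (count-⋃ {k = k} BadForSome? BadFor? (λ b → b) BadFor≤2ℓ))
        where
        BadForSome? : Decidable λ m → ∃ λ σ → BadFor σ m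
        BadForSome? m = any? λ σ → BadFor? σ m

    Unused : Pred (Fin k) 0ℓ
    Unused σ = ¬ ∃ (HeavyOfColour σ)

    Unused? : Decidable Unused
    Unused? σ = ¬? (any? (HeavyOfColour? σ))

    module _ {m : Fin t} (m-good : ¬ Bad m) where

      m≢i : m ≢ i
      m≢i = m-good ∘ inj₁

      K-colours-unused : ∀ {v} → K m v → Unused (col v)
      K-colours-unused {v} v∈K (_ , heavy-col) =
        col-proper (λ r≡i → proj₁ (proj₁ r-spec) (i , sym r≡i)) (K-avoids-ι m≢i v∈K) r~v (proj₂ r-spec)
        where
        r : Fin N
        r = representative (col v)
        r-spec : HeavyOfColour (col v) r
        r-spec = representative-spec heavy-col
        r~v : r ~ v
        r~v with r ~? v
        ... | yes r~v = r~v
        ... | no  r≁v = contradiction (inj₂ (col v , proj₁ r-spec , v , v∈K , ¬~⇒≁ r≁v)) m-good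

      K-m≤unused : count (K? m) ≤ count Unused?
      K-m≤unused = embedding⇒≤count Unused? (col ∘ enum (K? m)) col-injective
                     (K-colours-unused ∘ enum-∈ (K? m))
        where
        col-injective : Injective _≡_ _≡_ (col ∘ enum (K? m))
        col-injective {r} {r′} eq with enum (K? m) r ≟ enum (K? m) r′
        ... | yes same = enum-injective (K? m) same
        ... | no  diff = contradiction eq
          (col-proper (K-avoids-ι m≢i (enum-∈ (K? m) r)) (K-avoids-ι m≢i (enum-∈ (K? m) r′))
                      (K-clique (enum-∈ (K? m) r) (enum-∈ (K? m) r′) diff))

    K-i≤unused : count (K? i) ≤ count Unused?
    K-i≤unused with m , m-good ← good = ≤-trans (i-minimal m) (K-m≤unused m-good)

    recolour : Fin N → Fin k
    recolour x with K? i x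
    ... | yes x∈K = enum Unused? (inject≤ (rank (K? i) x x∈K) K-i≤unused)
    ... | no  _   = col x

    recolour-proper : ∀ x y → x ~ y → recolour x ≢ recolour y
    recolour-proper x y x~y with K? i x | K? i y
    ... | yes x∈K | yes y∈K = λ eq → ~⇒≢ x~y
      (rank-injective (K? i) x∈K y∈K (inject≤-injective _ _ _ _ (enum-injective Unused? eq)))
    ... | yes x∈K | no  y∉K = λ eq →
      enum-∈ Unused? _ (y , K-neighbour-heavy x∈K y∉K x~y , sym eq)
    ... | no  x∉K | yes y∈K = λ eq →
      enum-∈ Unused? _ (x , K-neighbour-heavy y∈K x∉K (adj-sym x~y) , eq)
    ... | no  x∉K | no  y∉K = col-proper (x∉K ∘ inj₁ ∘ sym) (y∉K ∘ inj₁ ∘ sym) x~y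

    colourable : Colourable G k
    colourable = recolour , recolour-proper

independence-bound : ℕ → ℕ → ℕ
independence-bound k ℓ = 2 + ℓ + k * (ℓ + ℓ)

critical⇒no-large-independent-set :
  ∀ {k ℓ N} (G : Graph N) → VertexCritical (suc k) G → Free (P3+ℓP1 ℓ) G →
  (ι : Fin (independence-bound k ℓ) → Fin N) → Injective _≡_ _≡_ ι → (∀ r s → adj G (ι r) (ι s) ≡ false) → ⊥
critical⇒no-large-independent-set {N = zero} G _ _ ι with () ← ι zero
critical⇒no-large-independent-set {k} {ℓ} {suc N} G crit@((_ , χ>k) , _) free ι ι-inj ι-indep =
  χ>k k (Recolouring.colourable i (proj₂ i-min) colouring (s≤s (s≤s (m≤n+m _ ℓ)))) ≤-refl
  where
  open LargeIndependentSet G ℓ free ι ι-inj ι-indep (m≤m+n (2 + ℓ) _)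
  i-min : ∃ λ i → ∀ m → count (K? i) ≤ count (K? m)
  i-min = argmin (count ∘ K?)
  i : Fin (independence-bound k ℓ)
  i = proj₁ i-min
  colouring : ColourableExcept G k (ι i)
  colouring = critical⇒colourableExcept {G = G} crit (punchInᵢ≢i i zero ∘ sym ∘ ι-inj)

critical⇒order≤ : ∀ {k ℓ n} (G : Graph n) → VertexCritical (suc k) G → Free (P3+ℓP1 ℓ) G →
                  n ≤ suc k * independence-bound k ℓ
critical⇒order≤ {n = zero} G _ _ = z≤n
critical⇒order≤ {k} {ℓ} {suc n} G crit@(((c , c-proper) , _) , _) free =
  ≤-trans (embedding⇒≤count U? id id (λ _ → tt))
          (count-⋃ U? (λ γ x → c x ≟ γ) (λ {x} _ → c x , refl) class-small)
  where
  class-small : ∀ γ → count (λ x → c x ≟ γ) ≤ independence-bound k ℓ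
  class-small γ with independence-bound k ℓ ≤? count (λ x → c x ≟ γ)
  ... | no  big≰ = <⇒≤ (≰⇒> big≰)
  ... | yes big≤ with ι , ι-inj , ι∈ ← ≤count⇒embedding (λ x → c x ≟ γ) big≤ =
    ⊥-elim (critical⇒no-large-independent-set G crit free ι ι-inj independent)
    where
    independent : ∀ r s → adj G (ι r) (ι s) ≡ false
    independent r s with adj G (ι r) (ι s) in r~s
    ... | true  = contradiction (trans (ι∈ r) (sym (ι∈ s))) (c-proper _ _ r~s)
    ... | false = refl

-- Listing all graphs of bounded order

vectors : ∀ {A : Set} → List A → (n : ℕ) → List (Vector A n)
vectors xs zero    = [ Vector.[] ]
vectors xs (suc n) = cartesianProductWith Vector._∷_ xs (vectors xs n)

vectors-complete : ∀ {A : Set} (R : Rel A 0ℓ) (xs : List A) → (∀ a → Any (R a) xs) →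
                   ∀ {n} (v : Vector A n) → Any (λ u → ∀ i → R (v i) (u i)) (vectors xs n)
vectors-complete R xs complete {zero}  v = here λ ()
vectors-complete R xs complete {suc n} v =
  cartesianProductWith⁺ Vector._∷_ (λ r rs → λ { zero → r ; (suc i) → rs i })
    (complete (v zero)) (vectors-complete R xs complete (tail v))

booleans : List Bool
booleans = true ∷ false ∷ []

booleans-complete : ∀ b → Any (b ≡_) booleans
booleans-complete true  = here refl
booleans-complete false = there (here refl)

adjacencies : (n : ℕ) → List (Fin n → Fin n → Bool)
adjacencies n = vectors (vectors booleans n) n

adjacencies-complete : ∀ {n} (f : Fin n → Fin n → Bool) →
                       Any (λ g → ∀ i j → f i j ≡ g i j) (adjacencies n)
adjacencies-complete {n} =
  vectors-complete _ _ (vectors-complete _≡_ booleans booleans-complete)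

fromUpperTriangle : ∀ {n} → (Fin n → Fin n → Bool) → Graph n
fromUpperTriangle {n} f = record { adj = a ; sym = a-sym ; irrefl = a-irrefl }
  where
  a : Fin n → Fin n → Bool
  a i j with <-cmp i j
  ... | tri< _ _ _ = f i j
  ... | tri≈ _ _ _ = false
  ... | tri> _ _ _ = f j i
  a-sym : ∀ i j → a i j ≡ a j i
  a-sym i j with <-cmp i j | <-cmp j i
  ... | tri< _ _ _   | tri> _ _ _   = refl
  ... | tri≈ _ _ _   | tri≈ _ _ _   = refl
  ... | tri> _ _ _   | tri< _ _ _   = refl
  ... | tri< _ _ j≮i | tri< j<i _ _ = contradiction j<i j≮i
  ... | tri< _ i≢j _ | tri≈ _ j≡i _ = contradiction (sym j≡i) i≢j
  ... | tri≈ _ i≡j _ | tri< _ j≢i _ = contradiction (sym i≡j) j≢i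
  ... | tri≈ _ i≡j _ | tri> _ j≢i _ = contradiction (sym i≡j) j≢i
  ... | tri> _ i≢j _ | tri≈ _ j≡i _ = contradiction (sym j≡i) i≢j
  ... | tri> i≮j _ _ | tri> _ _ i<j = contradiction i<j i≮j
  a-irrefl : ∀ i → a i i ≡ false
  a-irrefl i with <-cmp i i
  ... | tri< _ i≢i _ = contradiction refl i≢i
  ... | tri≈ _ _ _   = refl
  ... | tri> _ i≢i _ = contradiction refl i≢i

fromUpperTriangle-adj : ∀ {n} (G : Graph n) (f : Fin n → Fin n → Bool) → (∀ i j → adj G i j ≡ f i j) →
                        ∀ i j → adj G i j ≡ adj (fromUpperTriangle f) i j
fromUpperTriangle-adj G f G≗f i j with <-cmp i j
... | tri< _ _ _    = G≗f i j
... | tri≈ _ refl _ = irrefl G i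
... | tri> _ _ _    = trans (Graph.sym G i j) (G≗f j i)

graphsOfOrder : ℕ → List (Σ ℕ Graph)
graphsOfOrder n = map (λ f → n , fromUpperTriangle f) (adjacencies n)

graphsOfOrder-complete : ∀ {n} (G : Graph n) → Any (λ H → Iso G (proj₂ H)) (graphsOfOrder n)
graphsOfOrder-complete {n} G =
  map⁺ (Any.map (λ {f} G≗f → ↔-id (Fin n) , fromUpperTriangle-adj G f G≗f) (adjacencies-complete (adj G)))

graphsOfOrder≤ : ℕ → List (Σ ℕ Graph)
graphsOfOrder≤ zero    = graphsOfOrder zero
graphsOfOrder≤ (suc N) = graphsOfOrder≤ N ++ graphsOfOrder (suc N)

graphsOfOrder≤-complete : ∀ N {n} (G : Graph n) → n ≤ N → Any (λ H → Iso G (proj₂ H)) (graphsOfOrder≤ N)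
graphsOfOrder≤-complete zero    G z≤n = graphsOfOrder-complete G
graphsOfOrder≤-complete (suc N) G n≤1+N with m≤n⇒m<n∨m≡n n≤1+N
... | inj₁ n<1+N = ++⁺ˡ (graphsOfOrder≤-complete N G (≤-pred n<1+N))
... | inj₂ refl  = ++⁺ʳ (graphsOfOrder≤ N) (graphsOfOrder-complete G)

theorem3 : (k ℓ : ℕ) → 1 ≤ k →
    Σ (List (Σ ℕ Graph)) λ L →
    ∀ n (G : Graph n) → VertexCritical k G → Free (P3+ℓP1 ℓ) G →
    Any (λ { (m , H) → Iso G H }) L
theorem3 (suc k) ℓ _ = graphsOfOrder≤ (suc k * independence-bound k ℓ) ,
  λ n G crit free → Any.map id (graphsOfOrder≤-complete _ G (critical⇒order≤ G crit free))
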